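{- Let $n\ge 1$ and let $\mathcal{P}_n$ be the poset of lattice path matroids on $[n]$ ordered by the quotient order $\le_q$. Then the good pair labeling $\lambda$ of the Hasse diagram of $\mathcal{P}_n$ is an EL-labeling of $\mathcal{P}_n$. That is, for every $x\le_q y$ in $\mathcal{P}_n$: (i) the interval $[x,y]$ contains a unique maximal chain whose label sequence is weakly increasing with respect to the componentwise order on $[n]\times[n]$; and (ii) this chain $C$ satisfies $C<_L C'$ for every other maximal chain $C'$ of $[x,y]$, where $<_L$ is the lexicographic order on label sequences.
   Context: Identify a monotone lattice path from $(0,0)$ to $(n-k,k)$ with unit East and North steps with the $k$-subset of $[n]$ recording the positions of its North steps. For $k$-subsets $U=\{u_1<\dots<u_k\}$ and $L=\{\ell_1<\dots<\ell_k\}$ of $[n]$ with $u_i\le \ell_i$ for all $i$ (the path $U$ never goes below $L$), the lattice path matroid (LPM) $M[U,L]$ is the matroid on $[n]$ whose bases are the $k$-sets $\{b_1<\dots<b_k\}$ with $u_i\le b_i\le \ell_i$ for all $i$ (the lattice paths between $U$ and $L$); it has rank $k$, and different pairs $(U,L)$ give different matroids. A matroid $M'$ is a quotient of a matroid $M$ on the same ground set $E$ if there is a matroid $N$ on $E\sqcup T$ with $M=N\setminus T$ and $M'=N/T$. $\mathcal{P}_n$ is the set of all LPMs on $[n]$ (of all ranks $0,\dots,n$) with $M'\le_q M$ iff $M'$ is a quotient of $M$. Known characterization (used as the working description): a pair $(\ell_i,u_j)$ with $\ell_i\in L$, $u_j\in U$ is a good pair of $M[U,L]$ if $i\le j$ and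 $u_j-\ell_i\le j-i$; a sequence of pairs $((\ell^{(1)},u^{(1)}),\dots,(\ell^{(z)},u^{(z)}))$ is a good pairing of $M[U,L]$ if for each $r$, $(\ell^{(r)},u^{(r)})$ is a good pair of $M[U\setminus\{u^{(1)},\dots,u^{(r-1)}\},L\setminus\{\ell^{(1)},\dots,\ell^{(r-1)}\}]$ (indices taken relative to these sets). If $U'\subseteq U$, $L'\subseteq L$ with $U\setminus U'=\{a_1<\dots<a_z\}$, $L\setminus L'=\{b_1<\dots<b_z\}$, the greedy pairing is $((b_1,a_1),\dots,(b_z,a_z))$. Then $M[U',L']\le_q M[U,L]$ iff $U'\subseteq U$, $L'\subseteq L$ and the greedy pairing is good. In particular covers in $\mathcal{P}_n$ have the form $M[U\setminus\{u\},L\setminus\{\ell\}]\lessdot M[U,L]$. The good pair labeling assigns to this cover the label $(\ell,u)\in[n]\times[n]$, and $[n]\times[n]$ is ordered componentwise: $(\ell,u)\le(\ell',u')$ iff $\ell\le \ell'$ and $u\le u'$. The label sequence of a saturated chain $x_0\lessdot x_1\lessdot\cdots\lessdot x_k$ is $(\lambda(x_0\lessdot x_1),\dots,\lambda(x_{k-1}\lessdot x_k))$; it is weakly increasing if its $i$-th entry is $\le$ its $j$-th entry whenever $i\le j$; $C<_L C'$ if there is $j$ with the first $j-1$ labels equal and $\lambda(C)_j<\lambda(C')_j$. -}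

module Defs where

open import Data.Nat using (ℕ; zero; suc; _+_; _∸_; _≤_; _<_; _≟_)
open import Data.Product using (_×_; _,_; proj₁; proj₂; ∃-syntax)
open import Data.List using (List; []; _∷_; filter; zip; length)
open import Data.Maybe using (Maybe; just; nothing)
open import Data.Unit using (⊤)
open import Data.Empty using (⊥)
open import Data.Sum using (_⊎_)
open import Relation.Nullary using (¬_; ¬?)
open import Relation.Binary.PropositionalEquality using (_≡_)
open import Data.List.Relation.Unary.All using (All)
open import Data.List.Relation.Unary.AllPairs using (AllPairs)
open import Data.List.Relation.Binary.Pointwise using (Pointwise)
open import Data.List.Relation.Binary.Subset.Propositional using (_⊆_)
open import Data.List.Membership.DecPropositional _≟_ using (_∈?_)

-- A k-subset of [n] is a strictly increasing list of naturals in {1,…,n}.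
-- A lattice path matroid M[U,L] is identified with the pair (U , L)
-- (different pairs give different matroids).
LPMData : Set
LPMData = List ℕ × List ℕ

InRange : ℕ → ℕ → Set
InRange n a = 1 ≤ a × a ≤ n

IsSubsetOf[n] : ℕ → List ℕ → Set
IsSubsetOf[n] n xs = AllPairs _<_ xs × All (InRange n) xs

IsLPM : ℕ → LPMData → Set
IsLPM n (U , L) = IsSubsetOf[n] n U × IsSubsetOf[n] n L × Pointwise _≤_ U L

at : List ℕ → ℕ → Maybe ℕ
at [] _ = nothing
at (x ∷ xs) zero = just x
at (x ∷ xs) (suc i) = at xs i

_∖_ : List ℕ → List ℕ → List ℕ
xs ∖ ys = filter (λ a → ¬? (a ∈? ys)) xs

remove : ℕ → List ℕ → List ℕ
remove u xs = filter (λ a → ¬? (a ≟ u)) xs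

GoodPair : List ℕ → List ℕ → ℕ → ℕ → Set
GoodPair U L ℓ u =
  ∃[ i ] ∃[ j ] (at L i ≡ just ℓ × at U j ≡ just u × i ≤ j × u ≤ ℓ + (j ∸ i))

GoodPairing : List ℕ → List ℕ → List (ℕ × ℕ) → Set
GoodPairing U L [] = ⊤
GoodPairing U L ((ℓ , u) ∷ ps) =
  GoodPair U L ℓ u × GoodPairing (remove u U) (remove ℓ L) ps

greedy : LPMData → LPMData → List (ℕ × ℕ)
greedy (U' , L') (U , L) = zip (L ∖ L') (U ∖ U')

_≤q_ : LPMData → LPMData → Set
(U' , L') ≤q (U , L) =
  U' ⊆ U × L' ⊆ L × length (U ∖ U') ≡ length (L ∖ L')
  × GoodPairing U L (greedy (U' , L') (U , L))

Covers : ℕ → LPMData → LPMData → Set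
Covers n x y =
  IsLPM n x × IsLPM n y × x ≤q y × ¬ (x ≡ y)
  × (∀ z → IsLPM n z → x ≤q z → z ≤q y → z ≡ x ⊎ z ≡ y)

-- maximal chain x = x₀ ⋖ x₁ ⋖ ⋯ ⋖ x_k = y, listed as [x₁,…,x_k]
IsMaxChain : ℕ → LPMData → List LPMData → LPMData → Set
IsMaxChain n x [] y = x ≡ y
IsMaxChain n x (z ∷ zs) y = Covers n x z × IsMaxChain n z zs y

first : List ℕ → ℕ
first [] = 0
first (a ∷ _) = a

-- good pair label of the cover x ⋖ y (x = M[U∖{u},L∖{ℓ}], y = M[U,L]): (ℓ , u)
label : LPMData → LPMData → ℕ × ℕ
label (U' , L') (U , L) = (first (L ∖ L') , first (U ∖ U'))

labels : LPMData → List LPMData → List (ℕ × ℕ)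
labels x [] = []
labels x (z ∷ zs) = label x z ∷ labels z zs

_≤²_ : ℕ × ℕ → ℕ × ℕ → Set
(a , b) ≤² (c , d) = a ≤ c × b ≤ d

_<²_ : ℕ × ℕ → ℕ × ℕ → Set
p <² q = p ≤² q × ¬ (p ≡ q)

WeaklyIncreasing : List (ℕ × ℕ) → Set
WeaklyIncreasing = AllPairs _≤²_

data _<L_ : List (ℕ × ℕ) → List (ℕ × ℕ) → Set where
  here  : ∀ {a b as bs} → a <² b → (a ∷ as) <L (b ∷ bs)
  there : ∀ {a as bs} → as <L bs → (a ∷ as) <L (a ∷ bs)

{-# OPTIONS --safe #-}
-- In a cover x ⋖ w of 𝒫ₙ, w has exactly one element more than x in U and one more in L, and
-- the label of the cover is that pair. So the labels of any maximal chain from x to y are pairs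
-- from (Ly ∖ Lx) × (Uy ∖ Ux) exhausting both sets; the first label of a weakly increasing chain
-- is therefore componentwise below the first label of every maximal chain, and as a cover of x
-- is determined by its label, induction along the chains gives uniqueness and lexicographic
-- minimality. For existence, the last pair (m , v) of the greedy pairing of x ≤q y consists of
-- the largest elements of Ly ∖ Lx and Uy ∖ Ux. The earlier pairs lie strictly below it, so
-- removing each of them lowers the indices of m in L and of v in U by one, leaving j − i
-- unchanged: (m , v) is a good pair of y itself. Removing it gives a cover y′ ⋖ y, and the
-- rest of the greedy pairing witnesses x ≤q y′. Recursing on y′ gives a weakly increasing
-- chain to y′ whose labels are all below (m , v).
module Submission where

open import Defs
open import Data.Nat using (ℕ; zero; suc; _≤_; _<_; _≟_; s≤s)
open import Data.Nat.Properties using (≤-refl; ≤-trans; ≤-antisym; <⇒≤; <-trans; <-irrefl; <-asym; +-comm; suc-injective)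
open import Data.Product using (_×_; _,_; proj₁; proj₂; ∃-syntax; ∃₂)
open import Data.Product.Properties using (≡-dec)
open import Data.List using (List; []; _∷_; _∷ʳ_; _++_; zip; length; map)
open import Data.List.Properties using (filter-accept; filter-reject; filter-all; filter-none; length-++)
open import Data.List.Reverse using (Reverse; []; _∶_∶ʳ_; reverseView)
open import Data.Maybe using (just)
open import Data.Unit using (tt)
open import Data.Empty using (⊥-elim)
open import Data.Sum using (_⊎_; inj₁; inj₂)
open import Function using (id; _∘_)
open import Relation.Nullary using (¬_; ¬?; yes; no; contradiction)
open import Relation.Binary.PropositionalEquality using (_≡_; _≢_; refl; sym; trans; cong; cong₂; subst; subst₂; module ≡-Reasoning)
open import Data.List.Relation.Unary.All as All using (All; []; _∷_)
import Data.List.Relation.Unary.All.Properties as All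
open import Data.List.Relation.Unary.AllPairs as AllPairs using (AllPairs; []; _∷_)
import Data.List.Relation.Unary.AllPairs.Properties as AllPairs
open import Data.List.Relation.Binary.Pointwise using (Pointwise; _∷_)
open import Data.List.Relation.Binary.Subset.Propositional using (_⊆_)
open import Data.List.Relation.Binary.Subset.Propositional.Properties using (⊆-trans; ∈-∷⁺ʳ; ⊆∷∧∉⇒⊆)
open import Data.List.Membership.Propositional using (_∈_; _∉_)
open import Data.List.Membership.Propositional.Properties using (∈-filter⁺; ∈-filter⁻; ∈-++⁺ˡ; ∈-++⁺ʳ; ∈-++⁻; ∈-map⁺; ∈-map⁻)
open import Data.List.Membership.DecPropositional _≟_ using (_∈?_)
open import Data.List.Relation.Unary.Any using (here; there)

Sorted : List ℕ → Set
Sorted = AllPairs _<_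

head-< : ∀ {x xs e} → Sorted (x ∷ xs) → e ∈ xs → x < e
head-< s = All.lookup (AllPairs.head s)

head-≤ : ∀ {x xs e} → Sorted (x ∷ xs) → e ∈ x ∷ xs → x ≤ e
head-≤ _ (here refl) = ≤-refl
head-≤ s (there e∈) = <⇒≤ (head-< s e∈)

∈-tail : ∀ {x xs e} → e ∈ x ∷ xs → x < e → e ∈ xs
∈-tail (here refl) x<x = contradiction x<x (<-irrefl refl)
∈-tail (there e∈) _ = e∈

sorted-≡ : ∀ {xs ys} → Sorted xs → Sorted ys → xs ⊆ ys → ys ⊆ xs → xs ≡ ys
sorted-≡ {[]} {[]} _ _ _ _ = refl
sorted-≡ {[]} {y ∷ ys} _ _ _ ys⊆xs with () ← ys⊆xs (here refl)
sorted-≡ {x ∷ xs} {[]} _ _ xs⊆ys _ with () ← xs⊆ys (here refl)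
sorted-≡ {x ∷ xs} {y ∷ ys} sx sy xs⊆ys ys⊆xs
  with refl ← ≤-antisym (head-≤ sx (ys⊆xs (here refl))) (head-≤ sy (xs⊆ys (here refl))) =
  cong (x ∷_) (sorted-≡ (AllPairs.tail sx) (AllPairs.tail sy)
    (λ e∈ → ∈-tail (xs⊆ys (there e∈)) (head-< sx e∈))
    (λ e∈ → ∈-tail (ys⊆xs (there e∈)) (head-< sy e∈)))

allPairs-∷ʳ⁻ : ∀ {R : ℕ → ℕ → Set} {v} xs → AllPairs R (xs ∷ʳ v) → AllPairs R xs × All (λ x → R x v) xs
allPairs-∷ʳ⁻ [] _ = [] , []
allPairs-∷ʳ⁻ (x ∷ xs) (Rx ∷ Rxs) =
  All.++⁻ˡ xs Rx ∷ proj₁ (allPairs-∷ʳ⁻ xs Rxs) , All.head (All.++⁻ʳ xs Rx) ∷ proj₂ (allPairs-∷ʳ⁻ xs Rxs)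

unsnoc : ∀ (xs : List ℕ) → xs ≡ [] ⊎ ∃₂ λ ys y → xs ≡ ys ∷ʳ y
unsnoc xs with reverseView xs
... | [] = inj₁ refl
... | ys ∶ _ ∶ʳ y = inj₂ (ys , y , refl)

length-∷ʳ : ∀ {v : ℕ} xs → length (xs ∷ʳ v) ≡ suc (length xs)
length-∷ʳ xs = trans (length-++ xs) (+-comm (length xs) 1)

length≡0 : ∀ {xs : List ℕ} → length xs ≡ 0 → xs ≡ []
length≡0 {[]} _ = refl

length≡1 : ∀ {xs : List ℕ} → length xs ≡ 1 → xs ≡ first xs ∷ []
length≡1 {_ ∷ []} _ = refl

∈-remove⁺ : ∀ {u e xs} → e ∈ xs → e ≢ u → e ∈ remove u xs
∈-remove⁺ {u} = ∈-filter⁺ (λ a → ¬? (a ≟ u))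

∈-remove⁻ : ∀ {u e xs} → e ∈ remove u xs → e ∈ xs × e ≢ u
∈-remove⁻ {u} = ∈-filter⁻ (λ a → ¬? (a ≟ u))

∉-remove : ∀ {u xs} → u ∉ remove u xs
∉-remove {u} {xs} u∈ = proj₂ (∈-remove⁻ {u} {u} {xs} u∈) refl

remove-sorted : ∀ {u xs} → Sorted xs → Sorted (remove u xs)
remove-sorted {u} = AllPairs.filter⁺ (λ a → ¬? (a ≟ u))

⊆-remove : ∀ {u xs ys} → xs ⊆ ys → u ∉ xs → xs ⊆ remove u ys
⊆-remove xs⊆ys u∉xs e∈ = ∈-remove⁺ (xs⊆ys e∈) (λ { refl → u∉xs e∈ })

remove-∷-< : ∀ {u x xs} → x < u → remove u (x ∷ xs) ≡ x ∷ remove u xs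
remove-∷-< {u} x<u = filter-accept (λ a → ¬? (a ≟ u)) (λ { refl → <-irrefl refl x<u })

remove-head : ∀ {u xs} → Sorted (u ∷ xs) → remove u (u ∷ xs) ≡ xs
remove-head {u} s =
  trans (filter-reject (λ a → ¬? (a ≟ u)) (λ u≢u → u≢u refl))
        (filter-all (λ a → ¬? (a ≟ u)) (All.map (λ u<e e≡u → <-irrefl (sym e≡u) u<e) (AllPairs.head s)))

remove-comm : ∀ {u v xs} → Sorted xs → remove v (remove u xs) ≡ remove u (remove v xs)
remove-comm {u} {v} {xs} s =
  sorted-≡ (remove-sorted (remove-sorted s)) (remove-sorted (remove-sorted s)) (swap {u} {v}) (swap {v} {u})
  where
  swap : ∀ {u v} → remove v (remove u xs) ⊆ remove u (remove v xs)
  swap {u} {v} e∈ with e∈ₓ , e≢v ← ∈-remove⁻ {v} {_} {remove u xs} e∈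
                   with e∈xs , e≢u ← ∈-remove⁻ {u} {_} {xs} e∈ₓ =
    ∈-remove⁺ (∈-remove⁺ e∈xs e≢v) e≢u

∈-∖⁺ : ∀ {e xs ys} → e ∈ xs → e ∉ ys → e ∈ xs ∖ ys
∈-∖⁺ {ys = ys} = ∈-filter⁺ (λ a → ¬? (a ∈? ys))

∈-∖⁻ : ∀ {e xs ys} → e ∈ xs ∖ ys → e ∈ xs × e ∉ ys
∈-∖⁻ {ys = ys} = ∈-filter⁻ (λ a → ¬? (a ∈? ys))

∉-∖-self : ∀ {e xs} → e ∉ xs ∖ xs
∉-∖-self {e} {xs} e∈ with e∈xs , e∉xs ← ∈-∖⁻ {e} {xs} {xs} e∈ = e∉xs e∈xs

∖-self : ∀ xs → xs ∖ xs ≡ []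
∖-self xs = filter-none (λ a → ¬? (a ∈? xs)) (All.tabulate λ e∈ e∉ → e∉ e∈)

∖-sorted : ∀ {xs} ys → Sorted xs → Sorted (xs ∖ ys)
∖-sorted ys = AllPairs.filter⁺ (λ a → ¬? (a ∈? ys))

⊆-∖-++ : ∀ {xs ys} → ys ⊆ (ys ∖ xs) ++ xs
⊆-∖-++ {xs} e∈ with _ ∈? xs
... | yes e∈xs = ∈-++⁺ʳ _ e∈xs
... | no e∉xs = ∈-++⁺ˡ (∈-∖⁺ e∈ e∉xs)

∖≡⇒⊆ : ∀ {xs ys r} → ys ∖ xs ≡ r → ys ⊆ r ++ xs
∖≡⇒⊆ {xs} {ys} eq = subst (λ r → ys ⊆ r ++ xs) eq (⊆-∖-++ {xs} {ys})

∈-∖≡ : ∀ {a as xs ys} → ys ∖ xs ≡ a ∷ as → a ∈ ys × a ∉ xs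
∈-∖≡ eq = ∈-∖⁻ (subst (_ ∈_) (sym eq) (here refl))

∖≡∷ʳ⇒< : ∀ {v xs ys} zs → Sorted ys → ys ∖ xs ≡ zs ∷ʳ v → All (_< v) zs
∖≡∷ʳ⇒< {xs = xs} zs s eq = proj₂ (allPairs-∷ʳ⁻ zs (subst Sorted eq (∖-sorted xs s)))

∈-∖≡-last : ∀ {v xs ys} zs → ys ∖ xs ≡ zs ∷ʳ v → v ∈ ys × v ∉ xs
∈-∖≡-last zs eq = ∈-∖⁻ (subst (_ ∈_) (sym eq) (∈-++⁺ʳ zs (here refl)))

∷-⊆-∖ : ∀ {a xs ys zs rs} → xs ⊆ ys → ys ∖ xs ≡ a ∷ [] → ys ⊆ zs → rs ⊆ zs ∖ ys → a ∷ rs ⊆ zs ∖ xs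
∷-⊆-∖ {xs = xs} {ys} _ eq ys⊆zs _ (here refl) with a∈ys , a∉xs ← ∈-∖≡ {xs = xs} {ys} eq = ∈-∖⁺ (ys⊆zs a∈ys) a∉xs
∷-⊆-∖ {ys = ys} {zs} xs⊆ys _ _ rs⊆ (there e∈rs) with e∈zs , e∉ys ← ∈-∖⁻ {xs = zs} {ys} (rs⊆ e∈rs) =
  ∈-∖⁺ e∈zs (e∉ys ∘ xs⊆ys)

∖-⊆-∷ : ∀ {a xs ys zs rs} → ys ∖ xs ≡ a ∷ [] → zs ∖ ys ⊆ rs → zs ∖ xs ⊆ a ∷ rs
∖-⊆-∷ {xs = xs} {ys} {zs} eq ⊆rs {e} e∈ with e∈zs , e∉xs ← ∈-∖⁻ {e} {zs} {xs} e∈ with e ∈? ys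
... | yes e∈ys with here e≡a ← subst (e ∈_) eq (∈-∖⁺ e∈ys e∉xs) = here e≡a
... | no e∉ys = there (⊆rs (∈-∖⁺ e∈zs e∉ys))

∖-remove : ∀ {v xs} → Sorted xs → v ∈ xs → xs ∖ remove v xs ≡ v ∷ []
∖-remove {v} {xs} s v∈ =
  sorted-≡ (∖-sorted (remove v xs) s) ([] ∷ []) ⊆[v] (∈-∷⁺ʳ (∈-∖⁺ v∈ (∉-remove {v} {xs})) λ ())
  where
  ⊆[v] : xs ∖ remove v xs ⊆ v ∷ []
  ⊆[v] {e} e∈ with e∈xs , e∉ ← ∈-∖⁻ {e} {xs} e∈ with e ≟ v
  ... | yes e≡v = here e≡v
  ... | no e≢v = contradiction (∈-remove⁺ e∈xs e≢v) e∉

∖-remove-last : ∀ {v xs ys zs} → Sorted ys → ys ∖ xs ≡ zs ∷ʳ v → remove v ys ∖ xs ≡ zs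
∖-remove-last {v} {xs} {ys} {zs} s eq =
  sorted-≡ (∖-sorted xs (remove-sorted s)) (proj₁ zs-sorted) ⊆zs zs⊆
  where
  zs-sorted : Sorted zs × All (_< v) zs
  zs-sorted = allPairs-∷ʳ⁻ zs (subst Sorted eq (∖-sorted xs s))
  ⊆zs : remove v ys ∖ xs ⊆ zs
  ⊆zs {e} e∈ with e∈ᵣ , e∉xs ← ∈-∖⁻ {e} {remove v ys} e∈ with e∈ys , e≢v ← ∈-remove⁻ {v} {e} {ys} e∈ᵣ
    with ∈-++⁻ zs (subst (e ∈_) eq (∈-∖⁺ e∈ys e∉xs))
  ... | inj₁ e∈zs = e∈zs
  ... | inj₂ (here e≡v) = contradiction e≡v e≢v
  zs⊆ : zs ⊆ remove v ys ∖ xs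
  zs⊆ {e} e∈zs with e∈ys , e∉xs ← ∈-∖⁻ {e} {ys} (subst (e ∈_) (sym eq) (∈-++⁺ˡ e∈zs)) =
    ∈-∖⁺ (∈-remove⁺ e∈ys (λ { refl → <-irrefl refl (All.lookup (proj₂ zs-sorted) e∈zs) })) e∉xs

⊆-between : ∀ {a xs ys zs} → Sorted xs → Sorted ys → Sorted zs → xs ⊆ ys → ys ⊆ zs → zs ∖ xs ≡ a ∷ [] →
            ys ≡ xs ⊎ ys ≡ zs
⊆-between {a} {ys = ys} sx sy sz xs⊆ys ys⊆zs eq with a ∈? ys
... | yes a∈ys = inj₂ (sorted-≡ sy sz ys⊆zs (⊆-trans (∖≡⇒⊆ eq) (∈-∷⁺ʳ a∈ys xs⊆ys)))
... | no a∉ys = inj₁ (sorted-≡ sy sx (⊆∷∧∉⇒⊆ (⊆-trans ys⊆zs (∖≡⇒⊆ eq)) a∉ys) xs⊆ys)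

∖≡[-]-injective : ∀ {a xs ys zs} → Sorted ys → Sorted zs → xs ⊆ ys → xs ⊆ zs →
                  ys ∖ xs ≡ a ∷ [] → zs ∖ xs ≡ a ∷ [] → ys ≡ zs
∖≡[-]-injective sy sz xs⊆ys xs⊆zs eqy eqz =
  sorted-≡ sy sz (⊆-trans (∖≡⇒⊆ eqy) (∈-∷⁺ʳ (proj₁ (∈-∖≡ eqz)) xs⊆zs))
                 (⊆-trans (∖≡⇒⊆ eqz) (∈-∷⁺ʳ (proj₁ (∈-∖≡ eqy)) xs⊆ys))

at-∈ : ∀ xs {i e} → at xs i ≡ just e → e ∈ xs
at-∈ (_ ∷ xs) {zero} refl = here refl
at-∈ (_ ∷ xs) {suc i} eq = there (at-∈ xs eq)

at-remove-> : ∀ {xs i e v} → Sorted xs → at xs i ≡ just e → e < v → at (remove v xs) i ≡ just e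
at-remove-> {_ ∷ xs} {zero} _ refl e<v rewrite remove-∷-< {xs = xs} e<v = refl
at-remove-> {_ ∷ xs} {suc i} s eq e<v rewrite remove-∷-< {xs = xs} (<-trans (head-< s (at-∈ xs eq)) e<v) =
  at-remove-> (AllPairs.tail s) eq e<v

at-remove-< : ∀ {xs i e a} → Sorted xs → a ∈ xs → a < e → at (remove a xs) i ≡ just e → at xs (suc i) ≡ just e
at-remove-< {_ ∷ xs} s (here refl) _ eq rewrite remove-head s = eq
at-remove-< {_ ∷ xs} {zero} s (there a∈) a<x eq rewrite remove-∷-< {xs = xs} (head-< s a∈)
  with refl ← eq = contradiction (head-< s a∈) (<-asym a<x)
at-remove-< {_ ∷ xs} {suc i} s (there a∈) a<e eq rewrite remove-∷-< {xs = xs} (head-< s a∈) =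
  at-remove-< (AllPairs.tail s) a∈ a<e eq

goodPair-∈ : ∀ U L {ℓ u} → GoodPair U L ℓ u → ℓ ∈ L × u ∈ U
goodPair-∈ U L (_ , _ , Lᵢ≡ℓ , Uⱼ≡u , _) = at-∈ L Lᵢ≡ℓ , at-∈ U Uⱼ≡u

goodPair-remove-> : ∀ {U L ℓ u m v} → Sorted U → Sorted L → ℓ < m → u < v →
                    GoodPair U L ℓ u → GoodPair (remove v U) (remove m L) ℓ u
goodPair-remove-> sU sL ℓ<m u<v (i , j , Lᵢ≡ℓ , Uⱼ≡u , i≤j , gap) =
  i , j , at-remove-> sL Lᵢ≡ℓ ℓ<m , at-remove-> sU Uⱼ≡u u<v , i≤j , gap

goodPair-remove-< : ∀ {U L ℓ u b a} → Sorted U → Sorted L → b ∈ L → a ∈ U → b < ℓ → a < u →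
                    GoodPair (remove a U) (remove b L) ℓ u → GoodPair U L ℓ u
goodPair-remove-< sU sL b∈ a∈ b<ℓ a<u (i , j , Lᵢ≡ℓ , Uⱼ≡u , i≤j , gap) =
  suc i , suc j , at-remove-< sL b∈ b<ℓ Lᵢ≡ℓ , at-remove-< sU a∈ a<u Uⱼ≡u , s≤s i≤j , gap

-- After removing ℓ₁ and a later uⱼ, each uₖ with k < j faces ℓₖ₊₁ > ℓₖ ≥ uₖ.
pointwise-shift : ∀ {u l U L j a} → Sorted U → Sorted (l ∷ L) → u ≤ l → Pointwise _≤_ U L → at U j ≡ just a →
                  Pointwise _≤_ (u ∷ remove a U) L
pointwise-shift {j = zero} sU sL u≤l (_ ∷ pw) refl rewrite remove-head sU =
  ≤-trans u≤l (<⇒≤ (head-< sL (here refl))) ∷ pw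
pointwise-shift {U = u₂ ∷ U} {j = suc j} sU sL u≤l (u₂≤l₂ ∷ pw) eq
  rewrite remove-∷-< {xs = U} (head-< sU (at-∈ U eq)) =
  ≤-trans u≤l (<⇒≤ (head-< sL (here refl))) ∷ pointwise-shift (AllPairs.tail sU) (AllPairs.tail sL) u₂≤l₂ pw eq

pointwise-remove : ∀ {U L i j ℓ u} → Sorted U → Sorted L → Pointwise _≤_ U L →
                   at L i ≡ just ℓ → at U j ≡ just u → i ≤ j → Pointwise _≤_ (remove u U) (remove ℓ L)
pointwise-remove {i = zero} {zero} sU sL (_ ∷ pw) refl refl _ rewrite remove-head sU | remove-head sL = pw
pointwise-remove {U = u₁ ∷ U} {i = zero} {suc j} sU sL (u₁≤l₁ ∷ pw) refl Uⱼ≡u _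
  rewrite remove-head sL | remove-∷-< {xs = U} (head-< sU (at-∈ U Uⱼ≡u)) =
  pointwise-shift (AllPairs.tail sU) sL u₁≤l₁ pw Uⱼ≡u
pointwise-remove {_ ∷ U} {_ ∷ L} {suc i} {suc j} sU sL (u₁≤l₁ ∷ pw) Lᵢ≡ℓ Uⱼ≡u (s≤s i≤j)
  rewrite remove-∷-< {xs = L} (head-< sL (at-∈ L Lᵢ≡ℓ)) | remove-∷-< {xs = U} (head-< sU (at-∈ U Uⱼ≡u)) =
  u₁≤l₁ ∷ pointwise-remove (AllPairs.tail sU) (AllPairs.tail sL) pw Lᵢ≡ℓ Uⱼ≡u i≤j

U-sorted : ∀ {n U L} → IsLPM n (U , L) → Sorted U
U-sorted ((sU , _) , _) = sU

L-sorted : ∀ {n U L} → IsLPM n (U , L) → Sorted L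
L-sorted (_ , (sL , _) , _) = sL

remove-goodPair-isLPM : ∀ {n U L ℓ u} → IsLPM n (U , L) → GoodPair U L ℓ u → IsLPM n (remove u U , remove ℓ L)
remove-goodPair-isLPM {ℓ = ℓ} {u = u} ((sU , U∈[n]) , (sL , L∈[n]) , pw) (_ , _ , Lᵢ≡ℓ , Uⱼ≡u , i≤j , _) =
  (remove-sorted sU , All.filter⁺ (λ a → ¬? (a ≟ u)) U∈[n]) ,
  (remove-sorted sL , All.filter⁺ (λ a → ¬? (a ≟ ℓ)) L∈[n]) ,
  pointwise-remove sU sL pw Lᵢ≡ℓ Uⱼ≡u i≤j

remove-goodPair-≤q : ∀ {U L ℓ u} → Sorted U → Sorted L → GoodPair U L ℓ u → (remove u U , remove ℓ L) ≤q (U , L)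
remove-goodPair-≤q {U} {L} {ℓ} {u} sU sL good
  rewrite ∖-remove sU (proj₂ (goodPair-∈ U L good)) | ∖-remove sL (proj₁ (goodPair-∈ U L good)) =
  proj₁ ∘ ∈-remove⁻ {u} {_} {U} , proj₁ ∘ ∈-remove⁻ {ℓ} {_} {L} , refl , good , tt

≤q-∖≡[]⇒≡ : ∀ {n Ux Lx Uy Ly} → IsLPM n (Ux , Lx) → IsLPM n (Uy , Ly) → (Ux , Lx) ≤q (Uy , Ly) →
            Uy ∖ Ux ≡ [] → (Ux , Lx) ≡ (Uy , Ly)
≤q-∖≡[]⇒≡ lx ly (Ux⊆ , Lx⊆ , lengths , _) eqU =
  cong₂ _,_ (sorted-≡ (U-sorted lx) (U-sorted ly) Ux⊆ (∖≡⇒⊆ eqU))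
            (sorted-≡ (L-sorted lx) (L-sorted ly) Lx⊆ (∖≡⇒⊆ (length≡0 (trans (sym lengths) (cong length eqU)))))

≤q-∖≡∷ʳ : ∀ {Ux Lx Uy Ly A v} → (Ux , Lx) ≤q (Uy , Ly) → Uy ∖ Ux ≡ A ∷ʳ v → ∃₂ λ B m → Ly ∖ Lx ≡ B ∷ʳ m
≤q-∖≡∷ʳ {Lx = Lx} {Ly = Ly} {A} (_ , _ , lengths , _) eqU with unsnoc (Ly ∖ Lx)
... | inj₂ last = last
... | inj₁ eqL =
  contradiction (trans (sym (length-∷ʳ A)) (trans (cong length (sym eqU)) (trans lengths (cong length eqL))))
                λ ()

≤q-∖≡[-]⇒⋖ : ∀ {n Ux Lx Uy Ly a} → IsLPM n (Ux , Lx) → IsLPM n (Uy , Ly) → (Ux , Lx) ≤q (Uy , Ly) →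
             Uy ∖ Ux ≡ a ∷ [] → Covers n (Ux , Lx) (Uy , Ly)
≤q-∖≡[-]⇒⋖ {n} {Ux} {Lx} {Uy} {Ly} {a} lx ly x≤y@(_ , _ , lengths , _) eqU =
  lx , ly , x≤y , x≢y , nothing-between
  where
  eqL : Ly ∖ Lx ≡ first (Ly ∖ Lx) ∷ []
  eqL = length≡1 (trans (sym lengths) (cong length eqU))
  x≢y : (Ux , Lx) ≢ (Uy , Ly)
  x≢y refl = contradiction (subst (a ∈_) (sym eqU) (here refl)) (∉-∖-self {xs = Ux})
  nothing-between : ∀ z → IsLPM n z → (Ux , Lx) ≤q z → z ≤q (Uy , Ly) → z ≡ (Ux , Lx) ⊎ z ≡ (Uy , Ly)
  nothing-between (Uz , Lz) lz (Ux⊆ , Lx⊆ , lengths′ , _) (⊆Uy , ⊆Ly , _ , _)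
    with ⊆-between (U-sorted lx) (U-sorted lz) (U-sorted ly) Ux⊆ ⊆Uy eqU
       | ⊆-between (L-sorted lx) (L-sorted lz) (L-sorted ly) Lx⊆ ⊆Ly eqL
  ... | inj₁ refl | inj₁ refl = inj₁ refl
  ... | inj₂ refl | inj₂ refl = inj₂ refl
  ... | inj₁ refl | inj₂ refl =
    contradiction (trans (cong length (sym (∖-self Ux))) (trans lengths′ (cong length eqL))) λ ()
  ... | inj₂ refl | inj₁ refl =
    contradiction (trans (cong length (sym eqU)) (trans lengths′ (cong length (∖-self Lx)))) λ ()

remove-goodPair-⋖ : ∀ {n U L ℓ u} → IsLPM n (U , L) → GoodPair U L ℓ u →
                    Covers n (remove u U , remove ℓ L) (U , L)
remove-goodPair-⋖ {U = U} {L} l good =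
  ≤q-∖≡[-]⇒⋖ (remove-goodPair-isLPM l good) l (remove-goodPair-≤q (U-sorted l) (L-sorted l) good)
             (∖-remove (U-sorted l) (proj₂ (goodPair-∈ U L good)))

_≺_ : ℕ × ℕ → ℕ × ℕ → Set
(ℓ , u) ≺ (m , v) = ℓ < m × u < v

zip-≺ : ∀ {m v bs as} → All (_< m) bs → All (_< v) as → All (_≺ (m , v)) (zip bs as)
zip-≺ [] _ = []
zip-≺ (_ ∷ _) [] = []
zip-≺ (b<m ∷ bs<m) (a<v ∷ as<v) = (b<m , a<v) ∷ zip-≺ bs<m as<v

zip-∷ʳ : ∀ {m v : ℕ} bs as → length bs ≡ length as → zip (bs ∷ʳ m) (as ∷ʳ v) ≡ zip bs as ∷ʳ (m , v)
zip-∷ʳ [] [] _ = refl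
zip-∷ʳ (b ∷ bs) (a ∷ as) eq = cong ((b , a) ∷_) (zip-∷ʳ bs as (suc-injective eq))

goodPairing-∷ʳ⁻ : ∀ {U L m v} ps → Sorted U → Sorted L → All (_≺ (m , v)) ps →
                  GoodPairing U L (ps ∷ʳ (m , v)) → GoodPair U L m v × GoodPairing (remove v U) (remove m L) ps
goodPairing-∷ʳ⁻ [] _ _ [] (good , _) = good , tt
goodPairing-∷ʳ⁻ {U} {L} ((ℓ , u) ∷ ps) sU sL ((ℓ<m , u<v) ∷ ps≺) (good , rest)
  with last , init ← goodPairing-∷ʳ⁻ ps (remove-sorted sU) (remove-sorted sL) ps≺ rest =
  goodPair-remove-< sU sL (proj₁ (goodPair-∈ U L good)) (proj₂ (goodPair-∈ U L good)) ℓ<m u<v last ,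
  goodPair-remove-> sU sL ℓ<m u<v good ,
  subst₂ (λ U′ L′ → GoodPairing U′ L′ ps) (remove-comm sU) (remove-comm sL) init

last-greedy-pair : ∀ {Ux Lx Uy Ly A B v m} → Sorted Uy → Sorted Ly → (Ux , Lx) ≤q (Uy , Ly) →
                   Uy ∖ Ux ≡ A ∷ʳ v → Ly ∖ Lx ≡ B ∷ʳ m →
                   GoodPair Uy Ly m v × (Ux , Lx) ≤q (remove v Uy , remove m Ly)
last-greedy-pair {Ux} {Lx} {Uy} {Ly} {A} {B} {v} {m} sU sL (Ux⊆ , Lx⊆ , lengths , greedy-good) eqU eqL =
  proj₁ split ,
  ⊆-remove Ux⊆ (proj₂ (∈-∖≡-last {xs = Ux} {Uy} A eqU)) ,
  ⊆-remove Lx⊆ (proj₂ (∈-∖≡-last {xs = Lx} {Ly} B eqL)) ,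
  trans (cong length eqU′) (trans (sym |B|≡|A|) (cong length (sym eqL′))) ,
  subst₂ (λ bs as → GoodPairing (remove v Uy) (remove m Ly) (zip bs as)) (sym eqL′) (sym eqU′) (proj₂ split)
  where
  open ≡-Reasoning
  eqU′ : remove v Uy ∖ Ux ≡ A
  eqU′ = ∖-remove-last sU eqU
  eqL′ : remove m Ly ∖ Lx ≡ B
  eqL′ = ∖-remove-last sL eqL
  |B|≡|A| : length B ≡ length A
  |B|≡|A| = suc-injective (begin
    suc (length B)   ≡⟨ length-∷ʳ B ⟨
    length (B ∷ʳ m)  ≡⟨ cong length eqL ⟨
    length (Ly ∖ Lx) ≡⟨ lengths ⟨
    length (Uy ∖ Ux) ≡⟨ cong length eqU ⟩
    length (A ∷ʳ v)  ≡⟨ length-∷ʳ A ⟩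
    suc (length A)   ∎)
  greedy-good′ : GoodPairing Uy Ly (zip B A ∷ʳ (m , v))
  greedy-good′ = subst (GoodPairing Uy Ly) (zip-∷ʳ B A |B|≡|A|)
                       (subst₂ (λ bs as → GoodPairing Uy Ly (zip bs as)) eqL eqU greedy-good)
  split : GoodPair Uy Ly m v × GoodPairing (remove v Uy) (remove m Ly) (zip B A)
  split = goodPairing-∷ʳ⁻ (zip B A) sU sL (zip-≺ (∖≡∷ʳ⇒< B sL eqL) (∖≡∷ʳ⇒< A sU eqU)) greedy-good′

-- Otherwise removing the last greedy pair from w gives an element strictly between x and w.
⋖⇒length≡1 : ∀ {n Ux Lx Uw Lw} → Covers n (Ux , Lx) (Uw , Lw) → length (Uw ∖ Ux) ≡ 1
⋖⇒length≡1 {Ux = Ux} {Uw = Uw} {Lw} (lx , lw , x≤w , x≢w , nothing-between) with unsnoc (Uw ∖ Ux)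
... | inj₁ eqU = contradiction (≤q-∖≡[]⇒≡ lx lw x≤w eqU) x≢w
... | inj₂ ([] , v , eqU) = cong length eqU
... | inj₂ (a ∷ A , v , eqU)
  with B , m , eqL ← ≤q-∖≡∷ʳ {A = a ∷ A} x≤w eqU
  with good , x≤w′ ← last-greedy-pair {A = a ∷ A} (U-sorted lw) (L-sorted lw) x≤w eqU eqL
  with nothing-between (remove v Uw , remove m Lw) (remove-goodPair-isLPM lw good) x≤w′
                       (remove-goodPair-≤q (U-sorted lw) (L-sorted lw) good)
... | inj₁ w′≡x = contradiction (subst (λ U → a ∈ U ∖ Ux) (cong proj₁ w′≡x) a∈) (∉-∖-self {xs = Ux})
  where
  a∈ : a ∈ remove v Uw ∖ Ux
  a∈ = subst (a ∈_) (sym (∖-remove-last (U-sorted lw) eqU)) (here refl)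
... | inj₂ w′≡w = contradiction (subst (v ∈_) (cong proj₁ (sym w′≡w)) v∈) (∉-remove {v} {Uw})
  where
  v∈ : v ∈ Uw
  v∈ = proj₁ (∈-∖≡-last {xs = Ux} {Uw} (a ∷ A) eqU)

⋖-∖ : ∀ {n Ux Lx Uw Lw} → Covers n (Ux , Lx) (Uw , Lw) →
      Uw ∖ Ux ≡ proj₂ (label (Ux , Lx) (Uw , Lw)) ∷ [] × Lw ∖ Lx ≡ proj₁ (label (Ux , Lx) (Uw , Lw)) ∷ []
⋖-∖ x⋖w@(_ , _ , (_ , _ , lengths , _) , _) =
  length≡1 (⋖⇒length≡1 x⋖w) , length≡1 (trans (sym lengths) (⋖⇒length≡1 x⋖w))

⋖-label-injective : ∀ {n x w w′} → Covers n x w → Covers n x w′ → label x w ≡ label x w′ → w ≡ w′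
⋖-label-injective x⋖w@(_ , lw , (Ux⊆ , Lx⊆ , _) , _) x⋖w′@(_ , lw′ , (Ux⊆′ , Lx⊆′ , _) , _) eq =
  cong₂ _,_
    (∖≡[-]-injective (U-sorted lw) (U-sorted lw′) Ux⊆ Ux⊆′ (proj₁ (⋖-∖ x⋖w))
                     (trans (proj₁ (⋖-∖ x⋖w′)) (cong (λ p → proj₂ p ∷ []) (sym eq))))
    (∖≡[-]-injective (L-sorted lw) (L-sorted lw′) Lx⊆ Lx⊆′ (proj₂ (⋖-∖ x⋖w))
                     (trans (proj₂ (⋖-∖ x⋖w′)) (cong (λ p → proj₁ p ∷ []) (sym eq))))

chain-⊆ : ∀ {n Ux Lx Uy Ly} c → IsMaxChain n (Ux , Lx) c (Uy , Ly) → Ux ⊆ Uy × Lx ⊆ Ly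
chain-⊆ [] refl = id , id
chain-⊆ (_ ∷ c) ((_ , _ , (Ux⊆ , Lx⊆ , _) , _) , ch) =
  ⊆-trans Ux⊆ (proj₁ (chain-⊆ c ch)) , ⊆-trans Lx⊆ (proj₂ (chain-⊆ c ch))

labels⊆∖ : ∀ {n Ux Lx Uy Ly} c → IsMaxChain n (Ux , Lx) c (Uy , Ly) →
           map proj₂ (labels (Ux , Lx) c) ⊆ Uy ∖ Ux × map proj₁ (labels (Ux , Lx) c) ⊆ Ly ∖ Lx
labels⊆∖ [] refl = (λ ()) , (λ ())
labels⊆∖ (_ ∷ c) (x⋖w@(_ , _ , (Ux⊆ , Lx⊆ , _) , _) , ch) =
  ∷-⊆-∖ Ux⊆ (proj₁ (⋖-∖ x⋖w)) (proj₁ (chain-⊆ c ch)) (proj₁ (labels⊆∖ c ch)) ,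
  ∷-⊆-∖ Lx⊆ (proj₂ (⋖-∖ x⋖w)) (proj₂ (chain-⊆ c ch)) (proj₂ (labels⊆∖ c ch))

labels-below : ∀ {n Ux Lx Uy Ly m v} c → IsMaxChain n (Ux , Lx) c (Uy , Ly) →
               All (_< m) (Ly ∖ Lx) → All (_< v) (Uy ∖ Ux) → All (_≤² (m , v)) (labels (Ux , Lx) c)
labels-below c ch L<m U<v = All.tabulate λ {p} p∈ →
  <⇒≤ (All.lookup L<m (proj₂ (labels⊆∖ c ch) (∈-map⁺ proj₁ p∈))) ,
  <⇒≤ (All.lookup U<v (proj₁ (labels⊆∖ c ch) (∈-map⁺ proj₂ p∈)))

∖⊆labels : ∀ {n Ux Lx Uy Ly} c → IsMaxChain n (Ux , Lx) c (Uy , Ly) →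
           Uy ∖ Ux ⊆ map proj₂ (labels (Ux , Lx) c) × Ly ∖ Lx ⊆ map proj₁ (labels (Ux , Lx) c)
∖⊆labels {Ux = Ux} {Lx} [] refl = ⊥-elim ∘ ∉-∖-self {xs = Ux} , ⊥-elim ∘ ∉-∖-self {xs = Lx}
∖⊆labels {Ux = Ux} {Lx} {Uy} {Ly} ((Uw , Lw) ∷ c) (x⋖w , ch) =
  ∖-⊆-∷ {xs = Ux} {Uw} {Uy} (proj₁ (⋖-∖ x⋖w)) (proj₁ (∖⊆labels c ch)) ,
  ∖-⊆-∷ {xs = Lx} {Lw} {Ly} (proj₂ (⋖-∖ x⋖w)) (proj₂ (∖⊆labels c ch))

head-least : ∀ {p q ps} → WeaklyIncreasing (p ∷ ps) → q ∈ p ∷ ps → p ≤² q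
head-least _ (here refl) = ≤-refl , ≤-refl
head-least (p≤ps ∷ _) (there q∈ps) = All.lookup p≤ps q∈ps

≤²-antisym : ∀ {p q} → p ≤² q → q ≤² p → p ≡ q
≤²-antisym (ℓ≤ℓ′ , u≤u′) (ℓ′≤ℓ , u′≤u) = cong₂ _,_ (≤-antisym ℓ≤ℓ′ ℓ′≤ℓ) (≤-antisym u≤u′ u′≤u)

chain-irrefl : ∀ {n x w} c → ¬ IsMaxChain n x (w ∷ c) x
chain-irrefl {x = Ux , _} c ch = ∉-∖-self {xs = Ux} (proj₁ (labels⊆∖ (_ ∷ c) ch) (here refl))

first-label-least : ∀ {n x y w w′} c c′ → IsMaxChain n x (w ∷ c) y → WeaklyIncreasing (labels x (w ∷ c)) →
                    IsMaxChain n x (w′ ∷ c′) y → label x w ≤² label x w′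
first-label-least c c′ ch wi ch′
  with q , q∈ , ℓ′≡ ← ∈-map⁻ proj₁ (proj₂ (∖⊆labels (_ ∷ c) ch) (proj₂ (labels⊆∖ (_ ∷ c′) ch′) (here refl)))
  with r , r∈ , u′≡ ← ∈-map⁻ proj₂ (proj₁ (∖⊆labels (_ ∷ c) ch) (proj₁ (labels⊆∖ (_ ∷ c′) ch′) (here refl))) =
  subst (_ ≤_) (sym ℓ′≡) (proj₁ (head-least wi q∈)) , subst (_ ≤_) (sym u′≡) (proj₂ (head-least wi r∈))

increasing-chain-unique : ∀ {n x y} c c′ → IsMaxChain n x c y → WeaklyIncreasing (labels x c) →
                          IsMaxChain n x c′ y → WeaklyIncreasing (labels x c′) → c′ ≡ c
increasing-chain-unique [] [] refl _ refl _ = refl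
increasing-chain-unique [] (_ ∷ c′) refl _ ch′ _ = ⊥-elim (chain-irrefl c′ ch′)
increasing-chain-unique (_ ∷ c) [] ch _ refl _ = ⊥-elim (chain-irrefl c ch)
increasing-chain-unique (w ∷ c) (w′ ∷ c′) ch@(x⋖w , w→y) wi ch′@(x⋖w′ , w′→y) wi′
  with refl ← ⋖-label-injective x⋖w x⋖w′
                (≤²-antisym (first-label-least c c′ ch wi ch′) (first-label-least c′ c ch′ wi′ ch)) =
  cong (w ∷_) (increasing-chain-unique c c′ w→y (AllPairs.tail wi) w′→y (AllPairs.tail wi′))

increasing-chain-lex-least : ∀ {n x y} c c′ → IsMaxChain n x c y → WeaklyIncreasing (labels x c) →
                             IsMaxChain n x c′ y → c′ ≢ c → labels x c <L labels x c′
increasing-chain-lex-least [] [] refl _ refl c′≢c = contradiction refl c′≢c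
increasing-chain-lex-least [] (_ ∷ c′) refl _ ch′ _ = ⊥-elim (chain-irrefl c′ ch′)
increasing-chain-lex-least (_ ∷ c) [] ch _ refl _ = ⊥-elim (chain-irrefl c ch)
increasing-chain-lex-least {x = x} (w ∷ c) (w′ ∷ c′) ch@(x⋖w , w→y) wi ch′@(x⋖w′ , w′→y) c′≢c
  with ≡-dec _≟_ _≟_ (label x w) (label x w′)
... | no p≢p′ = here (first-label-least c c′ ch wi ch′ , p≢p′)
... | yes p≡p′ with refl ← ⋖-label-injective x⋖w x⋖w′ p≡p′ =
  there (increasing-chain-lex-least c c′ w→y (AllPairs.tail wi) w′→y (c′≢c ∘ cong (w ∷_)))

weaklyIncreasing-∷ʳ : ∀ {p ps} → WeaklyIncreasing ps → All (_≤² p) ps → WeaklyIncreasing (ps ∷ʳ p)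
weaklyIncreasing-∷ʳ wi ps≤p = AllPairs.++⁺ wi ([] ∷ []) (All.map (_∷ []) ps≤p)

chain-∷ʳ : ∀ {n x y′ y} c → IsMaxChain n x c y′ → Covers n y′ y → IsMaxChain n x (c ∷ʳ y) y
chain-∷ʳ [] refl y′⋖y = y′⋖y , refl
chain-∷ʳ (_ ∷ c) (x⋖w , w→y′) y′⋖y = x⋖w , chain-∷ʳ c w→y′ y′⋖y

labels-∷ʳ : ∀ {n x y′} y c → IsMaxChain n x c y′ → labels x (c ∷ʳ y) ≡ labels x c ∷ʳ label y′ y
labels-∷ʳ y [] refl = refl
labels-∷ʳ y (_ ∷ c) (_ , w→y′) = cong (_ ∷_) (labels-∷ʳ y c w→y′)

label-remove : ∀ {U L m v} → Sorted U → Sorted L → m ∈ L → v ∈ U →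
               label (remove v U , remove m L) (U , L) ≡ (m , v)
label-remove sU sL m∈L v∈U = cong₂ _,_ (cong first (∖-remove sL m∈L)) (cong first (∖-remove sU v∈U))

increasing-chain : ∀ {n Ux Lx Uy Ly A} → Reverse A → IsLPM n (Ux , Lx) → IsLPM n (Uy , Ly) →
                   (Ux , Lx) ≤q (Uy , Ly) → Uy ∖ Ux ≡ A →
                   ∃[ c ] (IsMaxChain n (Ux , Lx) c (Uy , Ly) × WeaklyIncreasing (labels (Ux , Lx) c))
increasing-chain [] lx ly x≤y eqU = [] , ≤q-∖≡[]⇒≡ lx ly x≤y eqU , []
increasing-chain {Ux = Ux} {Lx} {Uy} {Ly} (A ∶ rA ∶ʳ v) lx ly x≤y eqU
  with B , m , eqL ← ≤q-∖≡∷ʳ {A = A} x≤y eqU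
  with good , x≤y′ ← last-greedy-pair {A = A} (U-sorted ly) (L-sorted ly) x≤y eqU eqL
  with c , x→y′ , wi ← increasing-chain rA lx (remove-goodPair-isLPM ly good) x≤y′
                                        (∖-remove-last (U-sorted ly) eqU) =
  c ∷ʳ (Uy , Ly) , chain-∷ʳ c x→y′ (remove-goodPair-⋖ ly good) ,
  subst WeaklyIncreasing (sym (labels-∷ʳ (Uy , Ly) c x→y′))
    (weaklyIncreasing-∷ʳ wi (subst (λ p → All (_≤² p) (labels (Ux , Lx) c)) (sym last-label) below))
  where
  last-label : label (remove v Uy , remove m Ly) (Uy , Ly) ≡ (m , v)
  last-label =
    label-remove (U-sorted ly) (L-sorted ly) (proj₁ (goodPair-∈ Uy Ly good)) (proj₂ (goodPair-∈ Uy Ly good))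
  below : All (_≤² (m , v)) (labels (Ux , Lx) c)
  below = labels-below c x→y′
    (subst (All (_< m)) (sym (∖-remove-last (L-sorted ly) eqL)) (∖≡∷ʳ⇒< B (L-sorted ly) eqL))
    (subst (All (_< v)) (sym (∖-remove-last (U-sorted ly) eqU)) (∖≡∷ʳ⇒< A (U-sorted ly) eqU))

theorem3p1 : ∀ (n : ℕ) → 1 ≤ n → ∀ (x y : LPMData) → IsLPM n x → IsLPM n y → x ≤q y →
    ∃[ c ] (IsMaxChain n x c y × WeaklyIncreasing (labels x c)
      × (∀ c' → IsMaxChain n x c' y → WeaklyIncreasing (labels x c') → c' ≡ c)
      × (∀ c' → IsMaxChain n x c' y → ¬ (c' ≡ c) → labels x c <L labels x c'))
theorem3p1 n _ (Ux , Lx) (Uy , Ly) lx ly x≤y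
  with c , x→y , wi ← increasing-chain (reverseView (Uy ∖ Ux)) lx ly x≤y refl =
  c , x→y , wi ,
  (λ c′ x→y₂ wi′ → increasing-chain-unique c c′ x→y wi x→y₂ wi′) ,
  (λ c′ x→y₂ c′≢c → increasing-chain-lex-least c c′ x→y wi x→y₂ c′≢c)
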